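{- Let $G$ and $H$ be finite graphs and let $G\cup H$ denote their disjoint union. Then (i) $\gamma_{\rm MB}(G)+\gamma_{\rm MB}(H)\le \gamma_{\rm MB}(G\cup H)\le \min\{\gamma_{\rm MB}'(G)+\gamma_{\rm MB}(H),\ \gamma_{\rm MB}(G)+\gamma_{\rm MB}'(H)\}$; (ii) $\max\{\gamma_{\rm MB}'(G)+\gamma_{\rm MB}(H),\ \gamma_{\rm MB}(G)+\gamma_{\rm MB}'(H)\}\le \gamma_{\rm MB}'(G\cup H)\le \gamma_{\rm MB}'(G)+\gamma_{\rm MB}'(H)$. Moreover, each of these four bounds is sharp, i.e. attained with equality for some pair of graphs $G,H$.
   Context: All graphs are finite and simple. The Maker-Breaker domination game on a graph: Dominator and Staller alternately select a vertex not selected before; Dominator wins if at some point his selected vertices form a dominating set, Staller wins otherwise. In the D-game Dominator moves first, in the S-game Staller moves first. $\gamma_{\rm MB}(G)$ (resp. $\gamma_{\rm MB}'(G)$) is the minimum $k$ such that Dominator has a strategy in the D-game (resp. S-game) guaranteeing that his selected vertices dominate $G$ after at most $k$ of his moves, whatever Staller does, and is $\infty$ if he has no winning strategy. Arithmetic and comparisons follow the convention that $\infty+a=\infty$ and $\infty$ exceeds every integer. -}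

module Defs where

open import Data.Nat using (ℕ; zero; suc; _+_; _≤_)
open import Data.Bool using (Bool; true; false)
open import Data.Fin using (Fin; splitAt)
open import Data.Fin.Subset using (Subset; _∈_; _∉_; _∪_; ⁅_⁆; ⊥)
open import Data.Sum using (_⊎_; inj₁; inj₂)
open import Data.Product using (_×_; _,_; ∃; ∃-syntax; Σ)
open import Relation.Binary.PropositionalEquality using (_≡_)
open import Relation.Nullary using (¬_)

record Graph : Set where
  field
    order : ℕ
    adj   : Fin order → Fin order → Bool
    adj-sym    : ∀ u v → adj u v ≡ adj v u
    adj-irrefl : ∀ v → adj v v ≡ false
open Graph public

unionAdj : (G H : Graph) → Fin (order G + order H) → Fin (order G + order H) → Bool
unionAdj G H u v with splitAt (order G) u | splitAt (order G) v
... | inj₁ a | inj₁ b = adj G a b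
... | inj₂ a | inj₂ b = adj H a b
... | inj₁ _ | inj₂ _ = false
... | inj₂ _ | inj₁ _ = false

unionAdj-sym : (G H : Graph) → ∀ u v → unionAdj G H u v ≡ unionAdj G H v u
unionAdj-sym G H u v with splitAt (order G) u | splitAt (order G) v
... | inj₁ a | inj₁ b = adj-sym G a b
... | inj₂ a | inj₂ b = adj-sym H a b
... | inj₁ _ | inj₂ _ = Relation.Binary.PropositionalEquality.refl
... | inj₂ _ | inj₁ _ = Relation.Binary.PropositionalEquality.refl

unionAdj-irrefl : (G H : Graph) → ∀ v → unionAdj G H v v ≡ false
unionAdj-irrefl G H v with splitAt (order G) v
... | inj₁ a = adj-irrefl G a
... | inj₂ a = adj-irrefl H a

_⊔_ : Graph → Graph → Graph
G ⊔ H = record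
  { order = order G + order H
  ; adj = unionAdj G H
  ; adj-sym = unionAdj-sym G H
  ; adj-irrefl = unionAdj-irrefl G H
  }

Dominates : (G : Graph) → Subset (order G) → Set
Dominates G D = ∀ v → v ∈ D ⊎ (∃[ u ] (u ∈ D × adj G u v ≡ true))

Free : (G : Graph) → Subset (order G) → Subset (order G) → Fin (order G) → Set
Free G D S v = v ∉ D × v ∉ S

-- DomTurn G k D S : position with Dominator's set D, Staller's set S,
--   Dominator to move; Dominator can force that his vertices dominate G
--   using at most k further moves of his own.
-- StaTurn G k D S : same, with Staller to move.

mutual
  data DomTurn (G : Graph) : ℕ → Subset (order G) → Subset (order G) → Set where
    dom-done : ∀ {k D S} → Dominates G D → DomTurn G k D S
    dom-move : ∀ {k D S} (v : Fin (order G)) → Free G D S v →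
               StaTurn G k (D ∪ ⁅ v ⁆) S → DomTurn G (suc k) D S

  data StaTurn (G : Graph) : ℕ → Subset (order G) → Subset (order G) → Set where
    sta-done : ∀ {k D S} → Dominates G D → StaTurn G k D S
    sta-move : ∀ {k D S} →
               (∃[ v ] Free G D S v) →   -- Staller has a legal move (else the game ended undominated)
               (∀ v → Free G D S v → DomTurn G k D (S ∪ ⁅ v ⁆)) →
               StaTurn G k D S

-- Dominator wins the D-game (resp. S-game) within k of his moves.
WinsD : Graph → ℕ → Set
WinsD G k = DomTurn G k ⊥ ⊥

WinsS : Graph → ℕ → Set
WinsS G k = StaTurn G k ⊥ ⊥

data ℕ∞ : Set where
  fin : ℕ → ℕ∞
  ∞   : ℕ∞

infixl 6 _+∞_
_+∞_ : ℕ∞ → ℕ∞ → ℕ∞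
fin a +∞ fin b = fin (a + b)
fin _ +∞ ∞     = ∞
∞     +∞ _     = ∞

infix 4 _≤∞_
data _≤∞_ : ℕ∞ → ℕ∞ → Set where
  fin≤fin : ∀ {a b} → a ≤ b → fin a ≤∞ fin b
  _≤∞∞    : ∀ x → x ≤∞ ∞

min∞ : ℕ∞ → ℕ∞ → ℕ∞
min∞ ∞ y = y
min∞ x ∞ = x
min∞ (fin a) (fin b) = fin (Data.Nat._⊓_ a b)

max∞ : ℕ∞ → ℕ∞ → ℕ∞
max∞ ∞ _ = ∞
max∞ _ ∞ = ∞
max∞ (fin a) (fin b) = fin (Data.Nat._⊔_ a b)

-- "m is the least number of moves in which Dominator can force a win",
-- and ∞ if he has no winning strategy.

IsLeast : (ℕ → Set) → ℕ∞ → Set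
IsLeast P (fin k) = P k × (∀ j → P j → k ≤ j)
IsLeast P ∞       = ∀ j → ¬ P j

IsγMB : Graph → ℕ∞ → Set
IsγMB G = IsLeast (WinsD G)

IsγMB' : Graph → ℕ∞ → Set
IsγMB' G = IsLeast (WinsS G)

module Submission where

-- A winning strategy of Dominator on G ⊔ H restricts to winning strategies on G and on H whose
-- budgets add up: each component is a D-game or an S-game according to who moves there first.
-- Conversely, strategies on the components combine by always answering in the component
-- where Staller has just moved; once a component is dominated, a move of hers there is
-- answered in the other one as if she had passed. The subtle point of the restriction is a
-- position where Staller is to move: Dominator's play in the component she does not touch may
-- depend on her move, and has to be replaced by one of least budget.
-- Two copies of K₂ (γ_MB = γ'_MB = 1, and 2 for the union) attain all four bounds.

open import Defs
open import Data.Nat using (ℕ; zero; suc; _+_; _∸_; _<_; _≤_; z≤n; s≤s)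
open import Data.Nat.Properties
  using (≤-reflexive; ≤-trans; n≤1+n; m≤m+n; m≤n+m; +-comm; +-suc; +-identityʳ; +-mono-≤;
         m+n≤o⇒m≤o∸n; ∸-monoʳ-≤; m∸n+n≡m; ≮⇒≥; m<1+n⇒m<n∨m≡n; ⊓-glb; ⊔-lub)
open import Data.Bool using (true; false)
import Data.Bool as Bool
open import Data.Fin using (Fin; splitAt; _↑ˡ_; _↑ʳ_; _≟_)
open import Data.Fin.Patterns using (0F; 1F)
open import Data.Fin.Properties
  using (↑ˡ-injective; ↑ʳ-injective; splitAt-↑ˡ; splitAt-↑ʳ; splitAt⁻¹-↑ˡ; splitAt⁻¹-↑ʳ; any?; all?)
open import Data.Fin.Subset using (Subset; _∈_; _∉_; _∪_; ⁅_⁆; ⊥; ∁; _⊆_)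
open import Data.Fin.Subset.Properties
  using (_∈?_; ∉⊥; x∈⁅x⁆; x∈⁅y⁆⇒x≡y; x∈p∪q⁻; x∈p∪q⁺; p⊆p∪q; q⊆p∪q; ⊆-refl;
         x∈∁p⇒x∉p; x∉p⇒x∈∁p; p⊆q⇒∁p⊇∁q)
open import Data.Vec.Base using (there)
open import Data.Sum as Sum using (_⊎_; inj₁; inj₂)
open import Data.Product as Product using (_×_; _,_; ∃; ∃-syntax; proj₁; proj₂)
open import Data.Empty using (⊥-elim)
open import Function using (_∘_)
open import Function.Bundles using (_⇔_; mk⇔; Equivalence)
open import Function.Definitions using (Injective)
open import Relation.Binary.PropositionalEquality using (_≡_; _≢_; refl; sym; trans; cong; subst)
open import Relation.Nullary using (¬_; Dec; yes; no; ¬?; contradiction)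
open import Relation.Nullary.Decidable using (_×-dec_; _⊎-dec_; _→-dec_)

open Equivalence using (to; from)

private variable
  G H U : Graph
  a b j k k′ m n : ℕ
  g g′ h h′ u u′ : ℕ∞

least-number : {P : ℕ → Set} → (∀ n → Dec (P n)) → P n → ∃ λ m → IsLeast P (fin m)
least-number {n} {P} P? pn = search 0 n (λ _ ()) pn
  where
    search : ∀ i k → (∀ m → m < i → ¬ P m) → P (i + k) → ∃ λ m → IsLeast P (fin m)
    search i k none-below p with P? i
    ... | yes pi = i , pi , λ m pm → ≮⇒≥ (λ m<i → none-below m m<i pm)
    search i zero    none-below p | no ¬pi = contradiction (subst P (+-identityʳ i) p) ¬pi
    search i (suc k) none-below p | no ¬pi = search (suc i) k none-below′ (subst P (+-suc i k) p)
      where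
        none-below′ : ∀ m → m < suc i → ¬ P m
        none-below′ m m<1+i with m<1+n⇒m<n∨m≡n m<1+i
        ... | inj₁ m<i  = none-below m m<i
        ... | inj₂ refl = ¬pi

∪-lub : {p q r : Subset n} → p ⊆ r → q ⊆ r → p ∪ q ⊆ r
∪-lub {p = p} {q} p⊆r q⊆r x∈p∪q = Sum.[ p⊆r , q⊆r ] (x∈p∪q⁻ p q x∈p∪q)

∪-mono : {p p′ q q′ : Subset n} → p ⊆ p′ → q ⊆ q′ → p ∪ q ⊆ p′ ∪ q′
∪-mono {p′ = p′} {q′ = q′} p⊆p′ q⊆q′ = ∪-lub (p⊆p∪q q′ ∘ p⊆p′) (q⊆p∪q p′ q′ ∘ q⊆q′)

⁅⁆-⊆ : {p : Subset n} {v : Fin n} → v ∈ p → ⁅ v ⁆ ⊆ p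
⁅⁆-⊆ {p = p} {v} v∈p w∈⁅v⁆ = subst (_∈ p) (sym (x∈⁅y⁆⇒x≡y v w∈⁅v⁆)) v∈p

-- The game on one graph

module _ {G : Graph} where

  Dominates-mono : {D D′ : Subset (order G)} → D ⊆ D′ → Dominates G D → Dominates G D′
  Dominates-mono D⊆D′ dom v = Sum.map D⊆D′ (Product.map₂ (Product.map₁ D⊆D′)) (dom v)

  ¬Dominates-⊥ : Fin (order G) → ¬ Dominates G ⊥
  ¬Dominates-⊥ v dom with dom v
  ... | inj₁ v∈⊥            = ∉⊥ v∈⊥
  ... | inj₂ (_ , u∈⊥ , _) = ∉⊥ u∈⊥

  dominates? : (D : Subset (order G)) → Dec (Dominates G D)
  dominates? D = all? λ v → v ∈? D ⊎-dec any? λ u → u ∈? D ×-dec adj G u v Bool.≟ true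

  free? : (D S : Subset (order G)) (v : Fin (order G)) → Dec (Free G D S v)
  free? D S v = ¬? (v ∈? D) ×-dec ¬? (v ∈? S)

  -- D ∪ ∁ S is what Dominator owns or may still claim.
  no-free⇒D∪∁S⊆D : {D S : Subset (order G)} → (∀ v → ¬ Free G D S v) → D ∪ ∁ S ⊆ D
  no-free⇒D∪∁S⊆D {D = D} none = ∪-lub ⊆-refl claimable⊆D
    where
      claimable⊆D : ∁ _ ⊆ D
      claimable⊆D {v} v∈∁S with v ∈? D
      ... | yes v∈D = v∈D
      ... | no  v∉D = contradiction (v∉D , x∈∁p⇒x∉p v∈∁S) (none v)

  mutual
    DomTurn⇒D∪∁S-dominates : ∀ {D S} → DomTurn G k D S → Dominates G (D ∪ ∁ S)
    DomTurn⇒D∪∁S-dominates (dom-done dom) = Dominates-mono (p⊆p∪q _) dom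
    DomTurn⇒D∪∁S-dominates (dom-move {D = D} {S} v (_ , v∉S) s) =
      Dominates-mono (∪-lub (∪-lub (p⊆p∪q _) (⁅⁆-⊆ (q⊆p∪q D _ (x∉p⇒x∈∁p v∉S)))) (q⊆p∪q D _))
                     (StaTurn⇒D∪∁S-dominates s)

    StaTurn⇒D∪∁S-dominates : ∀ {D S} → StaTurn G k D S → Dominates G (D ∪ ∁ S)
    StaTurn⇒D∪∁S-dominates (sta-done dom) = Dominates-mono (p⊆p∪q _) dom
    StaTurn⇒D∪∁S-dominates (sta-move (v , fr) f) =
      Dominates-mono (∪-mono ⊆-refl (p⊆q⇒∁p⊇∁q (p⊆p∪q _))) (DomTurn⇒D∪∁S-dominates (f v fr))

  DomTurn-zero : ∀ {D S} → DomTurn G 0 D S → Dominates G D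
  DomTurn-zero (dom-done dom) = dom

  StaTurn-zero : ∀ {D S} → StaTurn G 0 D S → Dominates G D
  StaTurn-zero (sta-done dom)        = dom
  StaTurn-zero (sta-move (v , fr) f) = DomTurn-zero (f v fr)

  mutual
    DomTurn-≤ : ∀ {D S} → k ≤ k′ → DomTurn G k D S → DomTurn G k′ D S
    DomTurn-≤ _          (dom-done dom)    = dom-done dom
    DomTurn-≤ (s≤s k≤k′) (dom-move v fr s) = dom-move v fr (StaTurn-≤ k≤k′ s)

    StaTurn-≤ : ∀ {D S} → k ≤ k′ → StaTurn G k D S → StaTurn G k′ D S
    StaTurn-≤ _    (sta-done dom)  = sta-done dom
    StaTurn-≤ k≤k′ (sta-move v f) = sta-move v (λ w fr → DomTurn-≤ k≤k′ (f w fr))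

  -- When his strategy picks a vertex Dominator already owns, he skips the move. When Staller
  -- picks a vertex she owned before, or passes, he answers as if she had played any free vertex.
  mutual
    DomTurn-mono : ∀ {D D′ S S′} → D ⊆ D′ → S′ ⊆ S → DomTurn G k D S → DomTurn G k D′ S′
    DomTurn-mono D⊆D′ S′⊆S (dom-done dom) = dom-done (Dominates-mono D⊆D′ dom)
    DomTurn-mono {D′ = D′} D⊆D′ S′⊆S (dom-move v (_ , v∉S) s) with v ∈? D′
    ... | yes v∈D′ = DomTurn-≤ (n≤1+n _) (StaTurn⇒DomTurn (∪-lub D⊆D′ (⁅⁆-⊆ v∈D′)) S′⊆S s)
    ... | no  v∉D′ = dom-move v (v∉D′ , v∉S ∘ S′⊆S) (StaTurn-mono (∪-mono D⊆D′ ⊆-refl) S′⊆S s)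

    StaTurn-mono : ∀ {D D′ S S′} → D ⊆ D′ → S′ ⊆ S → StaTurn G k D S → StaTurn G k D′ S′
    StaTurn-mono D⊆D′ S′⊆S (sta-done dom) = sta-done (Dominates-mono D⊆D′ dom)
    StaTurn-mono {k = k} {D = D} {D′} {S} {S′} D⊆D′ S′⊆S t@(sta-move _ f) with any? (free? D′ S′)
    ... | no none =
      sta-done (Dominates-mono (no-free⇒D∪∁S⊆D (λ v fr → none (v , fr)) ∘
                                ∪-mono D⊆D′ (p⊆q⇒∁p⊇∁q S′⊆S))
                               (StaTurn⇒D∪∁S-dominates t))
    ... | yes free = sta-move free answer
      where
        answer : ∀ v → Free G D′ S′ v → DomTurn G k D′ (S′ ∪ ⁅ v ⁆)
        answer v (v∉D′ , v∉S′) with v ∈? S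
        ... | no  v∉S = DomTurn-mono D⊆D′ (∪-mono S′⊆S ⊆-refl) (f v (v∉D′ ∘ D⊆D′ , v∉S))
        ... | yes v∈S = StaTurn⇒DomTurn D⊆D′ (∪-lub S′⊆S (⁅⁆-⊆ v∈S)) t

    StaTurn⇒DomTurn : ∀ {D D′ S S′} → D ⊆ D′ → S′ ⊆ S → StaTurn G k D S → DomTurn G k D′ S′
    StaTurn⇒DomTurn D⊆D′ S′⊆S (sta-done dom)        = dom-done (Dominates-mono D⊆D′ dom)
    StaTurn⇒DomTurn D⊆D′ S′⊆S (sta-move (v , fr) f) = DomTurn-mono D⊆D′ (p⊆p∪q _ ∘ S′⊆S) (f v fr)

  mutual
    DomTurn? : ∀ k D S → Dec (DomTurn G k D S)
    DomTurn? k D S with dominates? D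
    ... | yes dom = yes (dom-done dom)
    DomTurn? zero    D S | no ¬dom = no λ { (dom-done dom) → ¬dom dom }
    DomTurn? (suc k) D S | no ¬dom with any? (λ v → free? D S v ×-dec StaTurn? k (D ∪ ⁅ v ⁆) S)
    ... | yes (v , fr , s) = yes (dom-move v fr s)
    ... | no ¬move = no λ { (dom-done dom) → ¬dom dom ; (dom-move v fr s) → ¬move (v , fr , s) }

    StaTurn? : ∀ k D S → Dec (StaTurn G k D S)
    StaTurn? k D S with dominates? D
    ... | yes dom = yes (sta-done dom)
    ... | no ¬dom with any? (free? D S) | all? (λ v → free? D S v →-dec DomTurn? k D (S ∪ ⁅ v ⁆))
    ... | yes free | yes answers = yes (sta-move free answers)
    ... | no ¬free | _           = no λ { (sta-done dom) → ¬dom dom ; (sta-move free _) → ¬free free }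
    ... | yes _    | no ¬answers =
      no λ { (sta-done dom) → ¬dom dom ; (sta-move _ answers) → ¬answers answers }

Preimage : (Fin m → Fin n) → Subset n → Subset m → Set
Preimage ι D D′ = ∀ x → x ∈ D′ ⇔ ι x ∈ D

module _ {ι : Fin m → Fin n} where

  preimage-⊥ : Preimage ι ⊥ ⊥
  preimage-⊥ x = mk⇔ (⊥-elim ∘ ∉⊥) (⊥-elim ∘ ∉⊥)

  preimage-∪ : ∀ {D D′ E E′} → Preimage ι D D′ → Preimage ι E E′ → Preimage ι (D ∪ E) (D′ ∪ E′)
  preimage-∪ {D} {D′} {E} {E′} pD pE x =
    mk⇔ (x∈p∪q⁺ ∘ Sum.map (to (pD x)) (to (pE x)) ∘ x∈p∪q⁻ D′ E′)
        (x∈p∪q⁺ ∘ Sum.map (from (pD x)) (from (pE x)) ∘ x∈p∪q⁻ D E)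

  preimage-∁ : ∀ {D D′} → Preimage ι D D′ → Preimage ι (∁ D) (∁ D′)
  preimage-∁ pD x = mk⇔ (λ x∈∁D′ → x∉p⇒x∈∁p (x∈∁p⇒x∉p x∈∁D′ ∘ from (pD x)))
                        (λ ιx∈∁D → x∉p⇒x∈∁p (x∈∁p⇒x∉p ιx∈∁D ∘ to (pD x)))

  preimage-⁅⁆ : Injective _≡_ _≡_ ι → ∀ x → Preimage ι ⁅ ι x ⁆ ⁅ x ⁆
  preimage-⁅⁆ ι-injective x x′ =
    mk⇔ (λ x′∈⁅x⁆ → subst (λ z → ι z ∈ ⁅ ι x ⁆) (sym (x∈⁅y⁆⇒x≡y x x′∈⁅x⁆)) (x∈⁅x⁆ (ι x)))
        (λ ιx′∈⁅ιx⁆ → subst (_∈ ⁅ x ⁆) (sym (ι-injective (x∈⁅y⁆⇒x≡y (ι x) ιx′∈⁅ιx⁆))) (x∈⁅x⁆ x))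

  preimage-∪-outside : ∀ {D D′ v} → (∀ x → ι x ≢ v) → Preimage ι D D′ → Preimage ι (D ∪ ⁅ v ⁆) D′
  preimage-∪-outside {D} {v = v} outside pD x =
    mk⇔ (p⊆p∪q _ ∘ to (pD x))
        (Sum.[ from (pD x) , ⊥-elim ∘ outside x ∘ x∈⁅y⁆⇒x≡y v ] ∘ x∈p∪q⁻ D ⁅ v ⁆)

  free-preimage : ∀ {D D′ S S′} → Preimage ι D D′ → Preimage ι S S′ →
                  ∀ x → (ι x ∉ D × ι x ∉ S) ⇔ (x ∉ D′ × x ∉ S′)
  free-preimage pD pS x = mk⇔ (Product.map (_∘ to (pD x)) (_∘ to (pS x)))
                              (Product.map (_∘ from (pD x)) (_∘ from (pS x)))

-- Graphs made of two components

record Decomposition (U G H : Graph) : Set where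
  field
    inl : Fin (order G) → Fin (order U)
    inr : Fin (order H) → Fin (order U)
    inl-injective : Injective _≡_ _≡_ inl
    inr-injective : Injective _≡_ _≡_ inr
    inl≢inr : ∀ x y → inl x ≢ inr y
    cover : ∀ v → (∃[ x ] inl x ≡ v) ⊎ (∃[ y ] inr y ≡ v)
    adj-inl : ∀ x x′ → adj U (inl x) (inl x′) ≡ adj G x x′
    adj-inr : ∀ y y′ → adj U (inr y) (inr y′) ≡ adj H y y′
    adj-inl-inr : ∀ x y → adj U (inl x) (inr y) ≡ false

  adj-inr-inl : ∀ y x → adj U (inr y) (inl x) ≡ false
  adj-inr-inl y x = trans (adj-sym U (inr y) (inl x)) (adj-inl-inr x y)

open Decomposition

swap : Decomposition U G H → Decomposition U H G
swap d = record
  { inl = inr d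
  ; inr = inl d
  ; inl-injective = inr-injective d
  ; inr-injective = inl-injective d
  ; inl≢inr = λ y x → inl≢inr d x y ∘ sym
  ; cover = Sum.swap ∘ cover d
  ; adj-inl = adj-inr d
  ; adj-inr = adj-inl d
  ; adj-inl-inr = adj-inr-inl d
  }

⊔-decomposition : (G H : Graph) → Decomposition (G ⊔ H) G H
⊔-decomposition G H = record
  { inl = _↑ˡ order H
  ; inr = order G ↑ʳ_
  ; inl-injective = ↑ˡ-injective (order H) _ _
  ; inr-injective = ↑ʳ-injective (order G) _ _
  ; inl≢inr = ↑ˡ≢↑ʳ
  ; cover = cover′
  ; adj-inl = adj-↑ˡ
  ; adj-inr = adj-↑ʳ
  ; adj-inl-inr = adj-↑ˡ-↑ʳ
  }
  where
    ↑ˡ≢↑ʳ : ∀ x y → x ↑ˡ order H ≢ order G ↑ʳ y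
    ↑ˡ≢↑ʳ x y eq with trans (sym (splitAt-↑ˡ (order G) x (order H)))
                            (trans (cong (splitAt (order G)) eq) (splitAt-↑ʳ (order G) (order H) y))
    ... | ()

    cover′ : ∀ v → (∃[ x ] x ↑ˡ order H ≡ v) ⊎ (∃[ y ] order G ↑ʳ y ≡ v)
    cover′ v with splitAt (order G) v in eq
    ... | inj₁ x = inj₁ (x , splitAt⁻¹-↑ˡ eq)
    ... | inj₂ y = inj₂ (y , splitAt⁻¹-↑ʳ eq)

    adj-↑ˡ : ∀ x x′ → unionAdj G H (x ↑ˡ order H) (x′ ↑ˡ order H) ≡ adj G x x′
    adj-↑ˡ x x′ rewrite splitAt-↑ˡ (order G) x (order H) | splitAt-↑ˡ (order G) x′ (order H) = refl

    adj-↑ʳ : ∀ y y′ → unionAdj G H (order G ↑ʳ y) (order G ↑ʳ y′) ≡ adj H y y′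
    adj-↑ʳ y y′ rewrite splitAt-↑ʳ (order G) (order H) y | splitAt-↑ʳ (order G) (order H) y′ = refl

    adj-↑ˡ-↑ʳ : ∀ x y → unionAdj G H (x ↑ˡ order H) (order G ↑ʳ y) ≡ false
    adj-↑ˡ-↑ʳ x y rewrite splitAt-↑ˡ (order G) x (order H) | splitAt-↑ʳ (order G) (order H) y = refl

Parts : Decomposition U G H → Subset (order U) → Subset (order G) → Subset (order H) → Set
Parts d D DG DH = Preimage (inl d) D DG × Preimage (inr d) D DH

parts-⊥ : (d : Decomposition U G H) → Parts d ⊥ ⊥ ⊥
parts-⊥ d = preimage-⊥ , preimage-⊥

parts-∪ˡ : (d : Decomposition U G H) → ∀ {D DG DH} → Parts d D DG DH →
            ∀ x → Parts d (D ∪ ⁅ inl d x ⁆) (DG ∪ ⁅ x ⁆) DH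
parts-∪ˡ d (pG , pH) x =
  preimage-∪ pG (preimage-⁅⁆ (inl-injective d) x) , preimage-∪-outside (λ y → inl≢inr d x y ∘ sym) pH

parts-∪ʳ : (d : Decomposition U G H) → ∀ {D DG DH} → Parts d D DG DH →
            ∀ y → Parts d (D ∪ ⁅ inr d y ⁆) DG (DH ∪ ⁅ y ⁆)
parts-∪ʳ d (pG , pH) y =
  preimage-∪-outside (λ x → inl≢inr d x y) pG , preimage-∪ pH (preimage-⁅⁆ (inr-injective d) y)

parts-swap : (d : Decomposition U G H) → ∀ {D DG DH} → Parts d D DG DH → Parts (swap d) D DH DG
parts-swap _ = Product.swap

free-inl : (d : Decomposition U G H) → ∀ {D DG DH S SG SH} → Parts d D DG DH → Parts d S SG SH →
           ∀ x → Free U D S (inl d x) ⇔ Free G DG SG x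
free-inl d cD cS = free-preimage (proj₁ cD) (proj₁ cS)

free-inr : (d : Decomposition U G H) → ∀ {D DG DH S SG SH} → Parts d D DG DH → Parts d S SG SH →
           ∀ y → Free U D S (inr d y) ⇔ Free H DH SH y
free-inr d cD cS = free-preimage (proj₂ cD) (proj₂ cS)

dominates-preimage : (d : Decomposition U G H) → ∀ {D DG} → Preimage (inl d) D DG →
                     Dominates U D → Dominates G DG
dominates-preimage d pG dom x with dom (inl d x)
... | inj₁ ιx∈D = inj₁ (from (pG x) ιx∈D)
... | inj₂ (u , u∈D , u~x) with cover d u
...   | inj₁ (x′ , refl) = inj₂ (x′ , from (pG x′) u∈D , trans (sym (adj-inl d x′ x)) u~x)
...   | inj₂ (y , refl)  = contradiction (trans (sym u~x) (adj-inr-inl d y x)) λ ()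

dominated-inl : (d : Decomposition U G H) → ∀ {D DG} → Preimage (inl d) D DG → Dominates G DG →
                ∀ x → inl d x ∈ D ⊎ ∃[ u ] (u ∈ D × adj U u (inl d x) ≡ true)
dominated-inl d pG dom x = Sum.map (to (pG x)) (λ (x′ , x′∈DG , x′~x) →
  inl d x′ , to (pG x′) x′∈DG , trans (adj-inl d x′ x) x′~x) (dom x)

dominates-join : (d : Decomposition U G H) → ∀ {D DG DH} → Parts d D DG DH →
                 Dominates G DG → Dominates H DH → Dominates U D
dominates-join d (pG , pH) domG domH v with cover d v
... | inj₁ (x , refl) = dominated-inl d pG domG x
... | inj₂ (y , refl) = dominated-inl (swap d) pH domH y

-- Combining strategies on the components

mutual
  StaTurn-liftʳ : (d : Decomposition U G H) → ∀ {D S DG DH SG SH} →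
                  Parts d D DG DH → Parts d S SG SH → Dominates G DG →
                  StaTurn H k DH SH → StaTurn U k D S
  StaTurn-liftʳ d cD cS domG (sta-done domH) = sta-done (dominates-join d cD domG domH)
  StaTurn-liftʳ {U = U} {k = k} d {D} {S} cD cS domG t@(sta-move (y , fr) f) =
    sta-move (inr d y , from (free-inr d cD cS y) fr) answer
    where
      answer : ∀ v → Free U D S v → DomTurn U k D (S ∪ ⁅ v ⁆)
      answer v fr′ with cover d v
      ... | inj₁ (x , refl) =
        DomTurn-liftʳ d cD (parts-∪ˡ d cS x) domG (StaTurn⇒DomTurn ⊆-refl ⊆-refl t)
      ... | inj₂ (y′ , refl) =
        DomTurn-liftʳ d cD (parts-∪ʳ d cS y′) domG (f y′ (to (free-inr d cD cS y′) fr′))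

  DomTurn-liftʳ : (d : Decomposition U G H) → ∀ {D S DG DH SG SH} →
                  Parts d D DG DH → Parts d S SG SH → Dominates G DG →
                  DomTurn H k DH SH → DomTurn U k D S
  DomTurn-liftʳ d cD cS domG (dom-done domH) = dom-done (dominates-join d cD domG domH)
  DomTurn-liftʳ d cD cS domG (dom-move y fr s) =
    dom-move (inr d y) (from (free-inr d cD cS y) fr)
             (StaTurn-liftʳ d (parts-∪ʳ d cD y) cS domG s)

mutual
  StaTurn-join : (d : Decomposition U G H) → ∀ {D S DG DH SG SH} →
                 Parts d D DG DH → Parts d S SG SH →
                 StaTurn G a DG SG → StaTurn H b DH SH → StaTurn U (a + b) D S
  StaTurn-join {b = b} d cD cS (sta-done domG) tH =
    StaTurn-≤ (m≤n+m b _) (StaTurn-liftʳ d cD cS domG tH)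
  StaTurn-join {a = a} d cD cS tG (sta-done domH) =
    StaTurn-≤ (m≤m+n a _) (StaTurn-liftʳ (swap d) (parts-swap d cD) (parts-swap d cS) domH tG)
  StaTurn-join {U = U} {a = a} {b} d {D} {S} cD cS tG@(sta-move (x , fr) fG) tH@(sta-move _ fH) =
    sta-move (inl d x , from (free-inl d cD cS x) fr) answer
    where
      answer : ∀ v → Free U D S v → DomTurn U (a + b) D (S ∪ ⁅ v ⁆)
      answer v fr′ with cover d v
      ... | inj₁ (x′ , refl) =
        DomTurn-joinˡ d cD (parts-∪ˡ d cS x′) (fG x′ (to (free-inl d cD cS x′) fr′)) tH
      ... | inj₂ (y′ , refl) =
        DomTurn-joinʳ d cD (parts-∪ʳ d cS y′) tG (fH y′ (to (free-inr d cD cS y′) fr′))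

  DomTurn-joinˡ : (d : Decomposition U G H) → ∀ {D S DG DH SG SH} →
                  Parts d D DG DH → Parts d S SG SH →
                  DomTurn G a DG SG → StaTurn H b DH SH → DomTurn U (a + b) D S
  DomTurn-joinˡ {b = b} d cD cS (dom-done domG) tH =
    DomTurn-≤ (m≤n+m b _) (DomTurn-liftʳ d cD cS domG (StaTurn⇒DomTurn ⊆-refl ⊆-refl tH))
  DomTurn-joinˡ d cD cS (dom-move x fr s) tH =
    dom-move (inl d x) (from (free-inl d cD cS x) fr)
             (StaTurn-join d (parts-∪ˡ d cD x) cS s tH)

  DomTurn-joinʳ : (d : Decomposition U G H) → ∀ {D S DG DH SG SH} →
                  Parts d D DG DH → Parts d S SG SH →
                  StaTurn G a DG SG → DomTurn H b DH SH → DomTurn U (a + b) D S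
  DomTurn-joinʳ {U = U} {a = a} {b} d {D} {S} cD cS tG tH =
    subst (λ k → DomTurn U k D S) (+-comm b a)
          (DomTurn-joinˡ (swap d) (parts-swap d cD) (parts-swap d cS) tH tG)

-- Splitting a strategy between the components

record Split (A B : ℕ → Set) (j : ℕ) : Set where
  constructor split
  field
    costˡ costʳ : ℕ
    within : costˡ + costʳ ≤ j
    winˡ : A costˡ
    winʳ : B costʳ

split-swap : ∀ {A B} → Split A B j → Split B A j
split-swap {j = j} (split a b a+b≤j wa wb) = split b a (subst (_≤ j) (+-comm a b) a+b≤j) wb wa

m+n≤o⇒p≤n⇒m≤o∸p : ∀ {o p} → m + n ≤ o → p ≤ n → m ≤ o ∸ p
m+n≤o⇒p≤n⇒m≤o∸p {m} {o = o} m+n≤o p≤n = ≤-trans (m+n≤o⇒m≤o∸n m m+n≤o) (∸-monoʳ-≤ o p≤n)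

StaTurn⇒no-freeˡ⇒dominates : (d : Decomposition U G H) → ∀ {D S DG DH SG SH} →
                             Parts d D DG DH → Parts d S SG SH → StaTurn U j D S →
                             (∀ x → ¬ Free G DG SG x) → Dominates G DG
StaTurn⇒no-freeˡ⇒dominates {G = G} d (pD , _) (pS , _) t none =
  Dominates-mono {G = G} (no-free⇒D∪∁S⊆D {G = G} none)
    (dominates-preimage d (preimage-∪ pD (preimage-∁ pS)) (StaTurn⇒D∪∁S-dominates t))

mutual
  DomTurn-split : (d : Decomposition U G H) → ∀ {D S DG DH SG SH} →
                  Parts d D DG DH → Parts d S SG SH → DomTurn U j D S →
                  Split (λ a → DomTurn G a DG SG) (λ b → DomTurn H b DH SH) j
  DomTurn-split d (pG , pH) cS (dom-done dom) =
    split 0 0 z≤n (dom-done (dominates-preimage d pG dom))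
                  (dom-done (dominates-preimage (swap d) pH dom))
  DomTurn-split d cD cS (dom-move v fr s) with cover d v
  ... | inj₁ (x , refl) with StaTurn-splitˡ d (parts-∪ˡ d cD x) cS s
  ...   | split a b a+b≤j sG wH =
    split (suc a) b (s≤s a+b≤j) (dom-move x (to (free-inl d cD cS x) fr) sG) wH
  DomTurn-split {j = suc j} d cD cS (dom-move v fr s) | inj₂ (y , refl)
    with StaTurn-splitʳ d (parts-∪ʳ d cD y) cS s
  ...   | split a b a+b≤j wG sH =
    split a (suc b) (subst (_≤ suc j) (sym (+-suc a b)) (s≤s a+b≤j)) wG
          (dom-move y (to (free-inr d cD cS y) fr) sH)

  -- Dominator's play in H may depend on where Staller moved in G; replacing it by a
  -- strategy of least budget β leaves every answer in G within j ∸ β moves.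
  StaTurn-splitˡ : (d : Decomposition U G H) → ∀ {D S DG DH SG SH} →
                   Parts d D DG DH → Parts d S SG SH → StaTurn U j D S →
                   Split (λ a → StaTurn G a DG SG) (λ b → DomTurn H b DH SH) j
  StaTurn-splitˡ d (pG , pH) cS (sta-done dom) =
    split 0 0 z≤n (sta-done (dominates-preimage d pG dom))
                  (dom-done (dominates-preimage (swap d) pH dom))
  StaTurn-splitˡ {G = G} {H} {j = j} d {D} {S} {DG} {DH} {SG} {SH} cD cS t@(sta-move (v , fr) f)
    with any? (free? {G = G} DG SG)
  ... | yes (x₀ , fr₀) =
    Product.uncurry optimal-in-H (least-number (λ b → DomTurn? b DH SH) (Split.winʳ (respond x₀ fr₀)))
    where
      respond : ∀ x → Free G DG SG x →
                Split (λ a → DomTurn G a DG (SG ∪ ⁅ x ⁆)) (λ b → DomTurn H b DH SH) j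
      respond x frx =
        DomTurn-split d cD (parts-∪ˡ d cS x) (f (inl d x) (from (free-inl d cD cS x) frx))

      optimal-in-H : ∀ β → IsLeast (λ b → DomTurn H b DH SH) (fin β) →
                     Split (λ a → StaTurn G a DG SG) (λ b → DomTurn H b DH SH) j
      optimal-in-H β (wβ , β-minimal) =
        split (j ∸ β) β (≤-reflexive (m∸n+n≡m β≤j)) (sta-move (x₀ , fr₀) answer) wβ
        where
          β≤j : β ≤ j
          β≤j with respond x₀ fr₀
          ... | split a b a+b≤j _ wH = ≤-trans (β-minimal b wH) (≤-trans (m≤n+m b a) a+b≤j)

          answer : ∀ x → Free G DG SG x → DomTurn G (j ∸ β) DG (SG ∪ ⁅ x ⁆)
          answer x frx with respond x frx
          ... | split a b a+b≤j wG wH = DomTurn-≤ (m+n≤o⇒p≤n⇒m≤o∸p a+b≤j (β-minimal b wH)) wG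
  ... | no none with cover d v
  ...   | inj₁ (x , refl) = contradiction (x , to (free-inl d cD cS x) fr) none
  ...   | inj₂ (y , refl) with DomTurn-split d cD (parts-∪ʳ d cS y) (f (inr d y) fr)
  ...     | split a b a+b≤j _ wH =
    split 0 b (≤-trans (m≤n+m b a) a+b≤j)
          (sta-done (StaTurn⇒no-freeˡ⇒dominates d cD cS t (λ x frx → none (x , frx))))
          (DomTurn-mono ⊆-refl (p⊆p∪q _) wH)

  StaTurn-splitʳ : (d : Decomposition U G H) → ∀ {D S DG DH SG SH} →
                   Parts d D DG DH → Parts d S SG SH → StaTurn U j D S →
                   Split (λ a → DomTurn G a DG SG) (λ b → StaTurn H b DH SH) j
  StaTurn-splitʳ d cD cS t =
    split-swap (StaTurn-splitˡ (swap d) (parts-swap d cD) (parts-swap d cS) t)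

IsLeast⇒≤∞ : ∀ {P x} → IsLeast P x → P a → x ≤∞ fin a
IsLeast⇒≤∞ {x = fin k} (_ , minimal) pa = fin≤fin (minimal _ pa)
IsLeast⇒≤∞ {x = ∞}     never         pa = ⊥-elim (never _ pa)

split-≥ : ∀ {PG PH x y} → IsLeast PG x → IsLeast PH y → Split PG PH j → x +∞ y ≤∞ fin j
split-≥ isG isH (split a b a+b≤j wa wb) with IsLeast⇒≤∞ isG wa | IsLeast⇒≤∞ isH wb
... | fin≤fin x≤a | fin≤fin y≤b = fin≤fin (≤-trans (+-mono-≤ x≤a y≤b) a+b≤j)

IsLeast-+∞-≥ : ∀ {PG PH PU x y u} → IsLeast PG x → IsLeast PH y → IsLeast PU u →
               (∀ {j} → PU j → Split PG PH j) → x +∞ y ≤∞ u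
IsLeast-+∞-≥ {u = ∞}     _   _   _        _         = _ ≤∞∞
IsLeast-+∞-≥ {u = fin j} isG isH (wj , _) splitting = split-≥ isG isH (splitting wj)

IsLeast-+∞-≤ : ∀ {PG PH PU x y u} → IsLeast PG x → IsLeast PH y → IsLeast PU u →
               (∀ {a b} → PG a → PH b → PU (a + b)) → u ≤∞ x +∞ y
IsLeast-+∞-≤ {x = fin a} {fin b} (wa , _) (wb , _) isU join = IsLeast⇒≤∞ isU (join wa wb)
IsLeast-+∞-≤ {x = fin a} {∞}     _ _ _ _ = _ ≤∞∞
IsLeast-+∞-≤ {x = ∞}             _ _ _ _ = _ ≤∞∞

min∞-glb : ∀ {u x y} → u ≤∞ x → u ≤∞ y → u ≤∞ min∞ x y
min∞-glb {x = ∞}               _           u≤y         = u≤y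
min∞-glb {x = fin _} {∞}       u≤x         _           = u≤x
min∞-glb {x = fin _} {fin _}   (fin≤fin p) (fin≤fin q) = fin≤fin (⊓-glb p q)

max∞-lub : ∀ {x y u} → x ≤∞ u → y ≤∞ u → max∞ x y ≤∞ u
max∞-lub {u = ∞}     _           _           = _ ≤∞∞
max∞-lub {u = fin _} (fin≤fin p) (fin≤fin q) = fin≤fin (⊔-lub p q)

module _ {G H : Graph} where

  private
    d : Decomposition (G ⊔ H) G H
    d = ⊔-decomposition G H

  γMB-⊔-≥ : IsγMB G g → IsγMB H h → IsγMB (G ⊔ H) u → g +∞ h ≤∞ u
  γMB-⊔-≥ isG isH isU = IsLeast-+∞-≥ isG isH isU (DomTurn-split d (parts-⊥ d) (parts-⊥ d))

  γMB-⊔-≤ : IsγMB G g → IsγMB' G g′ → IsγMB H h → IsγMB' H h′ → IsγMB (G ⊔ H) u →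
            u ≤∞ min∞ (g′ +∞ h) (g +∞ h′)
  γMB-⊔-≤ isG isG′ isH isH′ isU =
    min∞-glb (IsLeast-+∞-≤ isG′ isH isU (DomTurn-joinʳ d (parts-⊥ d) (parts-⊥ d)))
             (IsLeast-+∞-≤ isG isH′ isU (DomTurn-joinˡ d (parts-⊥ d) (parts-⊥ d)))

  γMB'-⊔-≥ : IsγMB G g → IsγMB' G g′ → IsγMB H h → IsγMB' H h′ → IsγMB' (G ⊔ H) u′ →
             max∞ (g′ +∞ h) (g +∞ h′) ≤∞ u′
  γMB'-⊔-≥ isG isG′ isH isH′ isU′ =
    max∞-lub (IsLeast-+∞-≥ isG′ isH isU′ (StaTurn-splitˡ d (parts-⊥ d) (parts-⊥ d)))
             (IsLeast-+∞-≥ isG isH′ isU′ (StaTurn-splitʳ d (parts-⊥ d) (parts-⊥ d)))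

  γMB'-⊔-≤ : IsγMB' G g′ → IsγMB' H h′ → IsγMB' (G ⊔ H) u′ → u′ ≤∞ g′ +∞ h′
  γMB'-⊔-≤ isG′ isH′ isU′ = IsLeast-+∞-≤ isG′ isH′ isU′ (StaTurn-join d (parts-⊥ d) (parts-⊥ d))

K₂ : Graph
K₂ = record { order = 2 ; adj = adjK₂ ; adj-sym = adjK₂-sym ; adj-irrefl = adjK₂-irrefl }
  where
    adjK₂ : Fin 2 → Fin 2 → Bool.Bool
    adjK₂ 0F 0F = false
    adjK₂ 0F 1F = true
    adjK₂ 1F 0F = true
    adjK₂ 1F 1F = false

    adjK₂-sym : ∀ u v → adjK₂ u v ≡ adjK₂ v u
    adjK₂-sym 0F 0F = refl
    adjK₂-sym 0F 1F = refl
    adjK₂-sym 1F 0F = refl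
    adjK₂-sym 1F 1F = refl

    adjK₂-irrefl : ∀ v → adjK₂ v v ≡ false
    adjK₂-irrefl 0F = refl
    adjK₂-irrefl 1F = refl

K₂-dominated : ∀ v → Dominates K₂ (⊥ ∪ ⁅ v ⁆)
K₂-dominated v w with v ≟ w
... | yes refl = inj₁ (q⊆p∪q ⊥ _ (x∈⁅x⁆ v))
... | no  v≢w  = inj₂ (v , q⊆p∪q ⊥ _ (x∈⁅x⁆ v) , adj-≢ v w v≢w)
  where
    adj-≢ : ∀ v w → v ≢ w → adj K₂ v w ≡ true
    adj-≢ 0F 0F 0≢0 = contradiction refl 0≢0
    adj-≢ 0F 1F _   = refl
    adj-≢ 1F 0F _   = refl
    adj-≢ 1F 1F 1≢1 = contradiction refl 1≢1

¬P0⇒1≤ : ∀ {P : ℕ → Set} → ¬ P 0 → ∀ j → P j → 1 ≤ j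
¬P0⇒1≤ ¬P0 zero    p0 = contradiction p0 ¬P0
¬P0⇒1≤ ¬P0 (suc j) _  = s≤s z≤n

K₂-γMB : IsγMB K₂ (fin 1)
K₂-γMB = dom-move 0F (∉⊥ , ∉⊥) (sta-done (K₂-dominated 0F))
       , ¬P0⇒1≤ (¬Dominates-⊥ {G = K₂} 0F ∘ DomTurn-zero)

K₂-γMB' : IsγMB' K₂ (fin 1)
K₂-γMB' = sta-move (0F , ∉⊥ , ∉⊥) other-vertex , ¬P0⇒1≤ (¬Dominates-⊥ {G = K₂} 0F ∘ StaTurn-zero)
  where
    other-vertex : ∀ v → Free K₂ ⊥ ⊥ v → DomTurn K₂ 1 ⊥ (⊥ ∪ ⁅ v ⁆)
    other-vertex 0F _ = dom-move 1F (∉⊥ , λ { (there ()) }) (sta-done (K₂-dominated 1F))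
    other-vertex 1F _ = dom-move 0F (∉⊥ , λ ()) (sta-done (K₂-dominated 0F))

K₂⊔K₂-γMB : IsγMB (K₂ ⊔ K₂) (fin 2)
K₂⊔K₂-γMB = DomTurn-joinʳ d (parts-⊥ d) (parts-⊥ d) (proj₁ K₂-γMB') (proj₁ K₂-γMB) , 2≤-moves
  where
    d : Decomposition (K₂ ⊔ K₂) K₂ K₂
    d = ⊔-decomposition K₂ K₂
    2≤-moves : ∀ j → WinsD (K₂ ⊔ K₂) j → 2 ≤ j
    2≤-moves j w with split-≥ K₂-γMB K₂-γMB (DomTurn-split d (parts-⊥ d) (parts-⊥ d) w)
    ... | fin≤fin 2≤j = 2≤j

K₂⊔K₂-γMB' : IsγMB' (K₂ ⊔ K₂) (fin 2)
K₂⊔K₂-γMB' = StaTurn-join d (parts-⊥ d) (parts-⊥ d) (proj₁ K₂-γMB') (proj₁ K₂-γMB') , 2≤-moves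
  where
    d : Decomposition (K₂ ⊔ K₂) K₂ K₂
    d = ⊔-decomposition K₂ K₂
    2≤-moves : ∀ j → WinsS (K₂ ⊔ K₂) j → 2 ≤ j
    2≤-moves j w with split-≥ K₂-γMB' K₂-γMB (StaTurn-splitˡ d (parts-⊥ d) (parts-⊥ d) w)
    ... | fin≤fin 2≤j = 2≤j

0<order-K₂ : 0 < order K₂
0<order-K₂ = s≤s z≤n

theorem6p1 :
    ((G H : Graph) (g g' h h' u u' : ℕ∞) →
       IsγMB G g → IsγMB' G g' → IsγMB H h → IsγMB' H h' →
       IsγMB (G ⊔ H) u → IsγMB' (G ⊔ H) u' →
       ((g +∞ h ≤∞ u) × (u ≤∞ min∞ (g' +∞ h) (g +∞ h')))
       × ((max∞ (g' +∞ h) (g +∞ h') ≤∞ u') × (u' ≤∞ g' +∞ h')))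
    × ((∃[ G ] ∃[ H ] (0 < order G) × (0 < order H) × ∃[ g ] ∃[ h ] ∃[ u ]
         (IsγMB G (fin g) × IsγMB H (fin h) × IsγMB (G ⊔ H) (fin u)
          × fin g +∞ fin h ≡ fin u))
     × (∃[ G ] ∃[ H ] (0 < order G) × (0 < order H) × ∃[ g ] ∃[ g' ] ∃[ h ] ∃[ h' ] ∃[ u ]
         (IsγMB G (fin g) × IsγMB' G (fin g') × IsγMB H (fin h) × IsγMB' H (fin h')
          × IsγMB (G ⊔ H) (fin u)
          × fin u ≡ min∞ (fin g' +∞ fin h) (fin g +∞ fin h')))
     × (∃[ G ] ∃[ H ] (0 < order G) × (0 < order H) × ∃[ g ] ∃[ g' ] ∃[ h ] ∃[ h' ] ∃[ u' ]
         (IsγMB G (fin g) × IsγMB' G (fin g') × IsγMB H (fin h) × IsγMB' H (fin h')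
          × IsγMB' (G ⊔ H) (fin u')
          × max∞ (fin g' +∞ fin h) (fin g +∞ fin h') ≡ fin u'))
     × (∃[ G ] ∃[ H ] (0 < order G) × (0 < order H) × ∃[ g' ] ∃[ h' ] ∃[ u' ]
         (IsγMB' G (fin g') × IsγMB' H (fin h') × IsγMB' (G ⊔ H) (fin u')
          × fin u' ≡ fin g' +∞ fin h')))
theorem6p1 =
    (λ G H g g' h h' u u' isG isG' isH isH' isU isU' →
        (γMB-⊔-≥ isG isH isU , γMB-⊔-≤ isG isG' isH isH' isU)
      , (γMB'-⊔-≥ isG isG' isH isH' isU' , γMB'-⊔-≤ isG' isH' isU'))
  , ( (K₂ , K₂ , 0<order-K₂ , 0<order-K₂ , 1 , 1 , 2 , K₂-γMB , K₂-γMB , K₂⊔K₂-γMB , refl)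
    , (K₂ , K₂ , 0<order-K₂ , 0<order-K₂ , 1 , 1 , 1 , 1 , 2
      , K₂-γMB , K₂-γMB' , K₂-γMB , K₂-γMB' , K₂⊔K₂-γMB , refl)
    , (K₂ , K₂ , 0<order-K₂ , 0<order-K₂ , 1 , 1 , 1 , 1 , 2
      , K₂-γMB , K₂-γMB' , K₂-γMB , K₂-γMB' , K₂⊔K₂-γMB' , refl)
    , (K₂ , K₂ , 0<order-K₂ , 0<order-K₂ , 1 , 1 , 2 , K₂-γMB' , K₂-γMB' , K₂⊔K₂-γMB' , refl))
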